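{- Let $\mathcal{H}'$ be the $7$-partite hypergraph whose vertices are pairs $(i,j)$ ($(i,j)$ being the $j$-th vertex of part $i$, $1\le i\le 7$), with the $22$ edges $E_1=\{(1,1),(2,1),(3,1),(4,1),(5,1),(6,1),(7,1)\}$, $E_2=\{(1,1),(2,2),(3,2),(4,2),(5,2),(6,3),(7,3)\}$, $E_3=\{(1,1),(2,3),(3,3),(4,3),(5,3),(6,4),(7,4)\}$, $E_4=\{(1,1),(2,4),(3,4),(4,4),(5,4),(6,5),(7,5)\}$, $E_5=\{(1,2),(2,1),(3,2),(4,3),(5,4),(6,6),(7,6)\}$, $E_6=\{(1,3),(2,1),(3,2),(4,5),(5,5),(6,4),(7,5)\}$, $E_7=\{(1,5),(2,3),(3,2),(4,6),(5,1),(6,5),(7,2)\}$, $E_8=\{(1,4),(2,2),(3,6),(4,1),(5,4),(6,4),(7,2)\}$, $E_9=\{(1,3),(2,5),(3,3),(4,1),(5,2),(6,5),(7,6)\}$, $E_{10}=\{(1,3),(2,6),(3,4),(4,3),(5,2),(6,1),(7,2)\}$, $E_{11}=\{(1,6),(2,2),(3,1),(4,3),(5,5),(6,5),(7,1)\}$, $E_{12}=\{(1,3),(2,3),(3,5),(4,2),(5,4),(6,2),(7,1)\}$, $E_{13}=\{(1,5),(2,3),(3,1),(4,4),(5,2),(6,4),(7,6)\}$, $E_{14}=\{(1,1),(2,6),(3,6),(4,6),(5,5),(6,2),(7,6)\}$, $E_{15}=\{(1,2),(2,3),(3,4),(4,1),(5,5),(6,3),(7,7)\}$, $E_{16}=\{(1,4),(2,1),(3,4),(4,2),(5,3),(6,5),(7,6)\}$,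 $E_{17}=\{(1,2),(2,5),(3,4),(4,6),(5,2),(6,4),(7,1)\}$, $E_{18}=\{(1,3),(2,6),(3,4),(4,3),(5,1),(6,4),(7,3)\}$, $E_{19}=\{(1,3),(2,1),(3,1),(4,6),(5,4),(6,3),(7,4)\}$, $E_{20}=\{(1,4),(2,3),(3,1),(4,3),(5,2),(6,2),(7,5)\}$, $E_{21}=\{(1,1),(2,3),(3,1),(4,3),(5,6),(6,4),(7,6)\}$, $E_{22}=\{(1,4),(2,6),(3,2),(4,1),(5,4),(6,4),(7,1)\}$. Then $\tau(\mathcal{H}') = 6$.
   Context: $\tau(\mathcal{H}')$ denotes the minimum size of a set of vertices of $\mathcal{H}'$ meeting every edge of $\mathcal{H}'$. -}

module Defs where

open import Data.Nat using (ℕ)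
open import Data.Fin using (Fin; #_)
open import Data.Product using (_×_; _,_)
open import Data.List using (List; []; _∷_)
open import Data.List.Membership.Propositional using (_∈_)
open import Data.List.Relation.Unary.All using (All)
open import Data.List.Relation.Unary.Any using (Any)

-- A vertex (i , j) : Fin 7 × Fin 7 stands for the paper's vertex (i+1 , j+1),
-- i.e. the (j+1)-th vertex of part i+1 (paper labels are 1-based, Fin is 0-based).
Vertex : Set
Vertex = Fin 7 × Fin 7

Edge : Set
Edge = List Vertex

edgesH' : List Edge
edgesH' =
  ( (# 0 , # 0) ∷ (# 1 , # 0) ∷ (# 2 , # 0) ∷ (# 3 , # 0) ∷ (# 4 , # 0) ∷ (# 5 , # 0) ∷ (# 6 , # 0) ∷ [] )
  ∷
  ( (# 0 , # 0) ∷ (# 1 , # 1) ∷ (# 2 , # 1) ∷ (# 3 , # 1) ∷ (# 4 , # 1) ∷ (# 5 , # 2) ∷ (# 6 , # 2) ∷ [] )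
  ∷
  ( (# 0 , # 0) ∷ (# 1 , # 2) ∷ (# 2 , # 2) ∷ (# 3 , # 2) ∷ (# 4 , # 2) ∷ (# 5 , # 3) ∷ (# 6 , # 3) ∷ [] )
  ∷
  ( (# 0 , # 0) ∷ (# 1 , # 3) ∷ (# 2 , # 3) ∷ (# 3 , # 3) ∷ (# 4 , # 3) ∷ (# 5 , # 4) ∷ (# 6 , # 4) ∷ [] )
  ∷
  ( (# 0 , # 1) ∷ (# 1 , # 0) ∷ (# 2 , # 1) ∷ (# 3 , # 2) ∷ (# 4 , # 3) ∷ (# 5 , # 5) ∷ (# 6 , # 5) ∷ [] )
  ∷
  ( (# 0 , # 2) ∷ (# 1 , # 0) ∷ (# 2 , # 1) ∷ (# 3 , # 4) ∷ (# 4 , # 4) ∷ (# 5 , # 3) ∷ (# 6 , # 4) ∷ [] )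
  ∷
  ( (# 0 , # 4) ∷ (# 1 , # 2) ∷ (# 2 , # 1) ∷ (# 3 , # 5) ∷ (# 4 , # 0) ∷ (# 5 , # 4) ∷ (# 6 , # 1) ∷ [] )
  ∷
  ( (# 0 , # 3) ∷ (# 1 , # 1) ∷ (# 2 , # 5) ∷ (# 3 , # 0) ∷ (# 4 , # 3) ∷ (# 5 , # 3) ∷ (# 6 , # 1) ∷ [] )
  ∷
  ( (# 0 , # 2) ∷ (# 1 , # 4) ∷ (# 2 , # 2) ∷ (# 3 , # 0) ∷ (# 4 , # 1) ∷ (# 5 , # 4) ∷ (# 6 , # 5) ∷ [] )
  ∷
  ( (# 0 , # 2) ∷ (# 1 , # 5) ∷ (# 2 , # 3) ∷ (# 3 , # 2) ∷ (# 4 , # 1) ∷ (# 5 , # 0) ∷ (# 6 , # 1) ∷ [] )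
  ∷
  ( (# 0 , # 5) ∷ (# 1 , # 1) ∷ (# 2 , # 0) ∷ (# 3 , # 2) ∷ (# 4 , # 4) ∷ (# 5 , # 4) ∷ (# 6 , # 0) ∷ [] )
  ∷
  ( (# 0 , # 2) ∷ (# 1 , # 2) ∷ (# 2 , # 4) ∷ (# 3 , # 1) ∷ (# 4 , # 3) ∷ (# 5 , # 1) ∷ (# 6 , # 0) ∷ [] )
  ∷
  ( (# 0 , # 4) ∷ (# 1 , # 2) ∷ (# 2 , # 0) ∷ (# 3 , # 3) ∷ (# 4 , # 1) ∷ (# 5 , # 3) ∷ (# 6 , # 5) ∷ [] )
  ∷
  ( (# 0 , # 0) ∷ (# 1 , # 5) ∷ (# 2 , # 5) ∷ (# 3 , # 5) ∷ (# 4 , # 4) ∷ (# 5 , # 1) ∷ (# 6 , # 5) ∷ [] )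
  ∷
  ( (# 0 , # 1) ∷ (# 1 , # 2) ∷ (# 2 , # 3) ∷ (# 3 , # 0) ∷ (# 4 , # 4) ∷ (# 5 , # 2) ∷ (# 6 , # 6) ∷ [] )
  ∷
  ( (# 0 , # 3) ∷ (# 1 , # 0) ∷ (# 2 , # 3) ∷ (# 3 , # 1) ∷ (# 4 , # 2) ∷ (# 5 , # 4) ∷ (# 6 , # 5) ∷ [] )
  ∷
  ( (# 0 , # 1) ∷ (# 1 , # 4) ∷ (# 2 , # 3) ∷ (# 3 , # 5) ∷ (# 4 , # 1) ∷ (# 5 , # 3) ∷ (# 6 , # 0) ∷ [] )
  ∷
  ( (# 0 , # 2) ∷ (# 1 , # 5) ∷ (# 2 , # 3) ∷ (# 3 , # 2) ∷ (# 4 , # 0) ∷ (# 5 , # 3) ∷ (# 6 , # 2) ∷ [] )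
  ∷
  ( (# 0 , # 2) ∷ (# 1 , # 0) ∷ (# 2 , # 0) ∷ (# 3 , # 5) ∷ (# 4 , # 3) ∷ (# 5 , # 2) ∷ (# 6 , # 3) ∷ [] )
  ∷
  ( (# 0 , # 3) ∷ (# 1 , # 2) ∷ (# 2 , # 0) ∷ (# 3 , # 2) ∷ (# 4 , # 1) ∷ (# 5 , # 1) ∷ (# 6 , # 4) ∷ [] )
  ∷
  ( (# 0 , # 0) ∷ (# 1 , # 2) ∷ (# 2 , # 0) ∷ (# 3 , # 2) ∷ (# 4 , # 5) ∷ (# 5 , # 3) ∷ (# 6 , # 5) ∷ [] )
  ∷
  ( (# 0 , # 3) ∷ (# 1 , # 5) ∷ (# 2 , # 1) ∷ (# 3 , # 0) ∷ (# 4 , # 3) ∷ (# 5 , # 3) ∷ (# 6 , # 0) ∷ [] )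
  ∷ []

IsTransversal : List Vertex → Set
IsTransversal S = All (λ E → Any (λ x → x ∈ S) E) edgesH'

module Submission where

-- Upper bound: the six vertices (1,1), … , (1,6) of the first part meet all
-- 22 edges, which is checked by evaluating the library's decision procedures.
--
-- Lower bound: the branching argument for transversals.  Every transversal S
-- of a hypergraph with an edge E contains some v ∈ E, and S without v is a
-- transversal of the edges avoiding v.  So if for every v ∈ E the edges
-- avoiding v need k vertices, the whole hypergraph needs k + 1.  Such
-- branching certificates form an inductive family `Needs`, developed for an
-- arbitrary hypergraph; their soundness (`needs-bound`) is the heart of the
-- proof.  Certificates are produced by a boolean search (`needs`) that
-- always branches on the first edge, and `needs-certificate` converts a
-- successful search into a certificate.  For H' the search succeeds for
-- k = 6, giving the lower bound.

open import Defs
open import Data.Nat using (ℕ; zero; suc; _≤_; z≤n; s≤s; _≡ᵇ_)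
open import Data.Nat.Properties using (≡⇒≡ᵇ)
open import Data.Fin using (toℕ)
open import Data.Fin.Properties using () renaming (_≟_ to _≟ᶠ_)
open import Data.Bool using (Bool; true; false; T; not; _∧_)
open import Data.Bool.Properties using (T-∧)
open import Data.Bool.ListAction using (all; any)
open import Data.Product using (_×_; ∃-syntax; _,_)
open import Data.Product.Properties using (≡-dec)
open import Data.Unit using (tt)
open import Data.List using (List; []; _∷_; _++_; length; filterᵇ)
open import Data.List.Relation.Unary.All using (All; all?)
import Data.List.Relation.Unary.All as All
open import Data.List.Relation.Unary.All.Properties using (all⁺)
open import Data.List.Relation.Unary.Any using (Any; any?; here; there)
import Data.List.Relation.Unary.Any as Any
open import Data.List.Relation.Unary.Any.Properties using (any⁺)
open import Data.List.Relation.Unary.Unique.Propositional using (Unique)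
open import Data.List.Membership.Propositional using (_∈_; _∉_; find)
open import Data.List.Membership.Propositional.Properties using (∈-∃++; ∈-filter⁻)
open import Data.List.Relation.Binary.Permutation.Propositional using (_↭_)
open import Data.List.Relation.Binary.Permutation.Propositional.Properties
  using (∈-resp-↭; ↭-length; shift)
open import Function using (_∘_; Equivalence)
open import Relation.Binary.Definitions using (DecidableEquality)
open import Relation.Binary.PropositionalEquality using (_≡_; refl; sym; subst)
open import Relation.Nullary using (¬_; contradiction; T?)
open import Relation.Nullary.Decidable using (toWitness)
import Data.List.Membership.DecPropositional as DecMembership
import Data.List.Relation.Unary.Unique.DecPropositional as DecUnique

split-off : ∀ {A : Set} {v : A} {S : List A} → v ∈ S → ∃[ S′ ] S ↭ v ∷ S′
split-off {v = v} v∈S with ys , zs , refl ← ∈-∃++ v∈S = ys ++ zs , shift v ys zs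

-- Vertices are compared by a boolean test _==_ which only has to be
-- reflexive: a test reporting "equal" too often can make the search below
-- fail, but never makes it produce a wrong certificate.
module Transversals {A : Set} (_==_ : A → A → Bool) (==-refl : ∀ x → T (x == x)) where

  Covers : List (List A) → List A → Set
  Covers Es S = All (Any (_∈ S)) Es

  _∈ᵇ_ : A → List A → Bool
  x ∈ᵇ F = any (x ==_) F

  ∈ᵇ-complete : ∀ {x F} → x ∈ F → T (x ∈ᵇ F)
  ∈ᵇ-complete = any⁺ _ ∘ Any.map (λ { refl → ==-refl _ })

  -- The edges of Es in which the test does not find v; by completeness of
  -- _∈ᵇ_ they really avoid v (avoiding-sound).
  avoiding : A → List (List A) → List (List A)
  avoiding v = filterᵇ (not ∘ (v ∈ᵇ_))

  avoiding-sound : ∀ {v F Es} → F ∈ avoiding v Es → F ∈ Es × v ∉ F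
  avoiding-sound {v} F∈ with F∈Es , v-not-found ← ∈-filter⁻ (T? ∘ (not ∘ (v ∈ᵇ_))) F∈ =
    F∈Es , λ v∈F → not-T v-not-found (∈ᵇ-complete v∈F)
    where
    not-T : ∀ {b} → T (not b) → ¬ T b
    not-T {false} _ ()

  meets-without : ∀ {v : A} {S′ F} → v ∉ F → Any (_∈ v ∷ S′) F → Any (_∈ S′) F
  meets-without v∉F (here (here refl)) = contradiction (here refl) v∉F
  meets-without v∉F (here (there w∈S′)) = here w∈S′
  meets-without v∉F (there met) = there (meets-without (v∉F ∘ there) met)

  covers-avoiding : ∀ {Es S S′ v} → Covers Es S → S ↭ v ∷ S′ → Covers (avoiding v Es) S′
  covers-avoiding cover S↭vS′ = All.tabulate λ F∈ →
    let F∈Es , v∉F = avoiding-sound F∈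
    in meets-without v∉F (Any.map (∈-resp-↭ S↭vS′) (All.lookup cover F∈Es))

  -- Needs k Es : every transversal of Es has at least k vertices, witnessed
  -- by branching on an edge E and, for each v ∈ E, on the edges avoiding v.
  data Needs : ℕ → List (List A) → Set where
    trivial : ∀ {Es} → Needs zero Es
    branch  : ∀ {k Es E} → E ∈ Es → All (λ v → Needs k (avoiding v Es)) E →
              Needs (suc k) Es

  needs-bound : ∀ {k Es S} → Needs k Es → Covers Es S → k ≤ length S
  needs-bound trivial _ = z≤n
  needs-bound {suc k} (branch E∈Es needs-rest) cover =
    let v , v∈E , v∈S = find (All.lookup cover E∈Es)
        S′ , S↭vS′    = split-off v∈S
        bound′        = needs-bound (All.lookup needs-rest v∈E) (covers-avoiding cover S↭vS′)
    in subst (suc k ≤_) (sym (↭-length S↭vS′)) (s≤s bound′)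

  needs : ℕ → List (List A) → Bool
  needs zero    _        = true
  needs (suc k) []       = false
  needs (suc k) (E ∷ Es) = all (λ v → needs k (avoiding v (E ∷ Es))) E

  needs-certificate : ∀ k Es → T (needs k Es) → Needs k Es
  needs-certificate zero    _        _  = trivial
  needs-certificate (suc k) (E ∷ Es) ok =
    branch (here refl) (All.map (λ {v} → needs-certificate k (avoiding v (E ∷ Es))) (all⁺ _ E ok))

-- A fast boolean equality test on vertices, via the builtin test on ℕ.
_==ᵛ_ : Vertex → Vertex → Bool
(i , j) ==ᵛ (k , l) = (toℕ i ≡ᵇ toℕ k) ∧ (toℕ j ≡ᵇ toℕ l)

==ᵛ-refl : ∀ x → T (x ==ᵛ x)
==ᵛ-refl (i , j) = Equivalence.from T-∧ (≡⇒≡ᵇ (toℕ i) _ refl , ≡⇒≡ᵇ (toℕ j) _ refl)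

_≟ᵛ_ : DecidableEquality Vertex
_≟ᵛ_ = ≡-dec _≟ᶠ_ _≟ᶠ_

open Transversals _==ᵛ_ ==ᵛ-refl
open DecMembership _≟ᵛ_ using (_∈?_)

firstPart : List Vertex
firstPart = (# 0 , # 0) ∷ (# 0 , # 1) ∷ (# 0 , # 2) ∷ (# 0 , # 3) ∷ (# 0 , # 4) ∷ (# 0 , # 5) ∷ []
  where open import Data.Fin using (#_)

firstPart-unique : Unique firstPart
firstPart-unique = toWitness {a? = DecUnique.unique? _≟ᵛ_ firstPart} tt

firstPart-transversal : IsTransversal firstPart
firstPart-transversal = toWitness {a? = all? (λ E → any? (_∈? firstPart) E) edgesH'} tt

H'-needs-six : Needs 6 edgesH'
H'-needs-six = needs-certificate 6 edgesH' tt

lemma5 : (∃[ S ] (Unique S × IsTransversal S × length S ≡ 6))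
         × (∀ (S : List Vertex) → Unique S → IsTransversal S → 6 ≤ length S)
lemma5 = (firstPart , firstPart-unique , firstPart-transversal , refl)
       , λ S _ S-transversal → needs-bound H'-needs-six S-transversal
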